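{- Let $G$ be an $n$-vertex graph with at least one edge and let $p\in[0,1]$. Then \[\Pr[B_p(G)\in\mathrm{ZFS}(G)]\le \sum_{v\in V(G)} d(v)\,p^{d(v)},\] where $d(v)$ is the degree of $v$ in $G$.
   Context: All graphs are finite and simple. Zero forcing: given a graph $G$ whose vertices are each colored blue or white, if a blue vertex $u$ has exactly one white neighbor $v$, then $v$ may be recolored blue; this rule is applied repeatedly. A set $B\subseteq V(G)$ is a zero forcing set of $G$ if, starting with exactly the vertices of $B$ blue, repeated application eventually colors all of $V(G)$ blue. $\mathrm{ZFS}(G)$ is the set of zero forcing sets of $G$. For $p\in[0,1]$, $B_p(G)$ is the random subset of $V(G)$ containing each vertex independently with probability $p$.
   Formalization: The parameter p ranges over the rationals in $[0,1]$. -}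

module Defs where

open import Data.Nat using (ℕ; zero; suc)
open import Data.Bool using (Bool; true; false; if_then_else_)
open import Data.Fin using (Fin)
open import Data.Fin.Subset using (Subset; Side; inside; outside; _∈_; ∣_∣)
open import Data.Vec using (Vec; []; _∷_)
open import Data.List using (List; []; _∷_; map; _++_; foldr; allFin)
open import Data.Product using (Σ; _×_)
open import Data.Integer using (+_)
open import Data.Rational using (ℚ; 0ℚ; 1ℚ; _+_; _*_; _-_; _/_)
open import Relation.Binary.PropositionalEquality using (_≡_; _≢_)
open import Relation.Nullary using (Dec; does)

record Graph (n : ℕ) : Set where
  field
    adj    : Fin n → Fin n → Bool
    symm   : ∀ u v → adj u v ≡ adj v u
    irrefl : ∀ v → adj v v ≡ false
open Graph public

HasEdge : ∀ {n} → Graph n → Set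
HasEdge {n} G = Σ (Fin n) λ u → Σ (Fin n) λ v → adj G u v ≡ true

sumℕ : List ℕ → ℕ
sumℕ = foldr Data.Nat._+_ 0

deg : ∀ {n} → Graph n → Fin n → ℕ
deg {n} G v = sumℕ (map (λ u → if adj G v u then 1 else 0) (allFin n))

-- Vertices that end up blue when the zero forcing rule is applied repeatedly
-- starting from the blue set B (the closure under the forcing rule):
-- v becomes blue if it is initially blue, or some blue vertex u adjacent to v
-- has all its other neighbours blue (so v is u's unique white neighbour).
data Blue {n : ℕ} (G : Graph n) (B : Subset n) : Fin n → Set where
  start : ∀ {v} → v ∈ B → Blue G B v
  force : ∀ u v → Blue G B u → adj G u v ≡ true →
          (∀ w → adj G u w ≡ true → w ≢ v → Blue G B w) → Blue G B v

IsZFS : ∀ {n} → Graph n → Subset n → Set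
IsZFS {n} G B = ∀ v → Blue G B v

fromℕℚ : ℕ → ℚ
fromℕℚ k = (+ k) / 1

_^ℚ_ : ℚ → ℕ → ℚ
x ^ℚ zero  = 1ℚ
x ^ℚ suc k = x * (x ^ℚ k)

sumℚ : List ℚ → ℚ
sumℚ = foldr _+_ 0ℚ

subsets : (n : ℕ) → List (Subset n)
subsets zero    = [] ∷ []
subsets (suc n) = map (outside ∷_) (subsets n) ++ map (inside ∷_) (subsets n)

-- Pr[B_p(G) ∈ ZFS(G)] = Σ_{B ∈ ZFS(G)} p^|B| (1-p)^(n-|B|),
-- computed using a decision procedure for membership in ZFS(G).
probZFS : ∀ {n} (G : Graph n) → (∀ B → Dec (IsZFS G B)) → ℚ → ℚ
probZFS {n} G dec p =
  sumℚ (map (λ B → if does (dec B)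
                     then (p ^ℚ ∣ B ∣) * ((1ℚ - p) ^ℚ (n Data.Nat.∸ ∣ B ∣))
                     else 0ℚ)
            (subsets n))

degBound : ∀ {n} → Graph n → ℚ → ℚ
degBound {n} G p = sumℚ (map (λ v → fromℕℚ (deg G v) * (p ^ℚ deg G v)) (allFin n))

{-# OPTIONS --safe #-}
module Submission where

-- If B is a zero forcing set, the first force is already possible from B: some
-- vertex u with a neighbour w has N[u] ∖ {w} ⊆ B. (If no force is possible nothing
-- outside B ever turns blue, so B = V, and then any edge uw gives one.) Since
-- |N[u] ∖ {w}| = d(u), this event has probability p^d(u), and the union bound
-- over the d(u) neighbours w of each u gives Σ_u d(u) p^d(u).

open import Defs
open import Data.Nat using (ℕ)
open import Data.Fin.Subset using (Subset)
open import Data.Rational using (ℚ; 0ℚ; 1ℚ; _≤_)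
open import Relation.Nullary using (Dec)

open import Data.Nat as ℕ using (zero; suc; _∸_)
import Data.Nat.Properties as ℕ
open import Data.Bool using (Bool; true; false; if_then_else_; T)
open import Data.Bool.Properties using (T-≡)
open import Data.Fin using (Fin; _≟_)
open import Data.Fin.Properties using (any?)
open import Data.Fin.Subset using (inside; outside; _∈_; _⊆_; ∣_∣)
open import Data.Fin.Subset.Properties using (_⊆?_; ∣p∣≤n)
open import Data.Vec using (Vec; []; _∷_; tabulate; lookup; _[_]≔_)
open import Data.Vec.Properties
  using (lookup∘tabulate; lookup∘update; lookup∘update′; []≔-lookup; []=⇒lookup)
open import Data.List as List using (List; []; _∷_; map; _++_; allFin)
open import Data.List.Properties using (map-tabulate)
open import Data.List.Relation.Unary.Any using (here; there)
open import Data.List.Membership.Propositional using () renaming (_∈_ to _∈ₗ_)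
open import Data.List.Membership.Propositional.Properties using (∈-allFin)
import Data.Nat.Coprimality as Coprime
import Data.Integer as ℤ
import Data.Integer.Properties as ℤ
open import Data.Rational using (_+_; _*_; _-_; -_; mkℚ; _/_; nonNegative)
import Data.Rational.Properties as ℚ
open import Data.Rational.Solver using (module +-*-Solver)
open import Data.Product using (_×_; _,_; ∃; ∃₂)
open import Data.Sum using (_⊎_; inj₁; inj₂)
open import Data.Empty using (⊥-elim)
open import Function using (id; _∘_; Equivalence)
open import Relation.Nullary using (¬_; yes; no; does)
open import Relation.Nullary.Decidable using (T?; _×-dec_; dec-true)
open import Relation.Binary.PropositionalEquality

open +-*-Solver using (solve; _:=_; _:+_; _:*_; _:-_; con)

fromℕℚ-suc : ∀ k → fromℕℚ (suc k) ≡ 1ℚ + fromℕℚ k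
fromℕℚ-suc k = begin
  ℤ.+ suc k / 1                  ≡⟨ ℚ./-cong (cong (ℤ._+_ ℤ.1ℤ) (sym (ℤ.*-identityʳ (ℤ.+ k)))) refl ⟩
  (ℤ.1ℤ ℤ.+ ℤ.+ k ℤ.* ℤ.1ℤ) / 1 ≡⟨⟩
  1ℚ + mkℚ (ℤ.+ k) 0 k⊥1         ≡⟨ cong (1ℚ +_) (sym (ℚ.normalize-coprime k⊥1)) ⟩
  1ℚ + fromℕℚ k                  ∎
  where
  open ≡-Reasoning
  k⊥1 : Coprime.Coprime k 1
  k⊥1 = Coprime.sym (Coprime.1-coprimeTo k)

*-nonNeg : ∀ {x y} → 0ℚ ≤ x → 0ℚ ≤ y → 0ℚ ≤ x * y
*-nonNeg {x} {y} 0≤x 0≤y =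
  ℚ.nonNegative⁻¹ (x * y) {{ℚ.nonNeg*nonNeg⇒nonNeg x {{nonNegative 0≤x}} y {{nonNegative 0≤y}}}}

^ℚ-nonNeg : ∀ {x} k → 0ℚ ≤ x → 0ℚ ≤ x ^ℚ k
^ℚ-nonNeg zero    0≤x = ℚ.nonNegative⁻¹ 1ℚ
^ℚ-nonNeg (suc k) 0≤x = *-nonNeg 0≤x (^ℚ-nonNeg k 0≤x)

p≤1⇒0≤1-p : ∀ {p} → p ≤ 1ℚ → 0ℚ ≤ 1ℚ - p
p≤1⇒0≤1-p {p} p≤1 = subst (_≤ 1ℚ - p) (ℚ.+-inverseʳ p) (ℚ.+-monoˡ-≤ (- p) p≤1)

if-nonNeg : ∀ b {x} → 0ℚ ≤ x → 0ℚ ≤ (if b then x else 0ℚ)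
if-nonNeg true  0≤x = 0≤x
if-nonNeg false _   = ℚ.≤-refl

if-*ʳ : ∀ b c x → (if b then c * x else 0ℚ) ≡ c * (if b then x else 0ℚ)
if-*ʳ true  c x = refl
if-*ʳ false c x = sym (ℚ.*-zeroʳ c)

if-does-yes : ∀ {A : Set} (a? : Dec A) {x} → A → (if does a? then x else 0ℚ) ≡ x
if-does-yes a? a rewrite dec-true a? a = refl

module _ {A : Set} where

  ∑ : List A → (A → ℚ) → ℚ
  ∑ xs f = sumℚ (map f xs)

  infix 9 ∑
  syntax ∑ xs (λ x → e) = ∑[ x ← xs ] e

  ∑-++ : ∀ f xs ys → ∑ (xs ++ ys) f ≡ ∑ xs f + ∑ ys f
  ∑-++ f []       ys = sym (ℚ.+-identityˡ _)
  ∑-++ f (x ∷ xs) ys = trans (cong (f x +_) (∑-++ f xs ys)) (sym (ℚ.+-assoc (f x) _ _))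

  ∑-cong : ∀ {f g} → (∀ x → f x ≡ g x) → ∀ xs → ∑ xs f ≡ ∑ xs g
  ∑-cong f≗g []       = refl
  ∑-cong f≗g (x ∷ xs) = cong₂ _+_ (f≗g x) (∑-cong f≗g xs)

  ∑-mono-≤ : ∀ {f g} → (∀ x → f x ≤ g x) → ∀ xs → ∑ xs f ≤ ∑ xs g
  ∑-mono-≤ f≤g []       = ℚ.≤-refl
  ∑-mono-≤ f≤g (x ∷ xs) = ℚ.+-mono-≤ (f≤g x) (∑-mono-≤ f≤g xs)

  ∑-zero : ∀ xs → ∑[ x ← xs ] 0ℚ ≡ 0ℚ
  ∑-zero []       = refl
  ∑-zero (x ∷ xs) = trans (cong (0ℚ +_) (∑-zero xs)) (ℚ.+-identityˡ 0ℚ)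

  ∑-distrib-+ : ∀ f g xs → ∑[ x ← xs ] (f x + g x) ≡ ∑ xs f + ∑ xs g
  ∑-distrib-+ f g []       = sym (ℚ.+-identityˡ 0ℚ)
  ∑-distrib-+ f g (x ∷ xs) =
    trans (cong (f x + g x +_) (∑-distrib-+ f g xs)) (interchange (f x) (g x) _ _)
    where
    interchange : ∀ a b c d → (a + b) + (c + d) ≡ (a + c) + (b + d)
    interchange = solve 4 (λ a b c d → (a :+ b) :+ (c :+ d) := (a :+ c) :+ (b :+ d)) refl

  ∑-distribˡ-* : ∀ c f xs → ∑[ x ← xs ] (c * f x) ≡ c * ∑ xs f
  ∑-distribˡ-* c f []       = sym (ℚ.*-zeroʳ c)
  ∑-distribˡ-* c f (x ∷ xs) =
    trans (cong (c * f x +_) (∑-distribˡ-* c f xs)) (sym (ℚ.*-distribˡ-+ c (f x) _))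

  ∑-nonNeg : ∀ {f} → (∀ x → 0ℚ ≤ f x) → ∀ xs → 0ℚ ≤ ∑ xs f
  ∑-nonNeg 0≤f []       = ℚ.≤-refl
  ∑-nonNeg 0≤f (x ∷ xs) = ℚ.+-mono-≤ (0≤f x) (∑-nonNeg 0≤f xs)

  ∈⇒≤∑ : ∀ {f} → (∀ x → 0ℚ ≤ f x) → ∀ {x xs} → x ∈ₗ xs → f x ≤ ∑ xs f
  ∈⇒≤∑ {f} 0≤f {xs = y ∷ xs} (here refl) =
    subst (_≤ f y + ∑ xs f) (ℚ.+-identityʳ (f y)) (ℚ.+-monoʳ-≤ (f y) (∑-nonNeg 0≤f xs))
  ∈⇒≤∑ {f} 0≤f {xs = y ∷ xs} (there x∈xs) = ℚ.≤-trans (∈⇒≤∑ 0≤f x∈xs)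
    (subst (_≤ f y + ∑ xs f) (ℚ.+-identityˡ (∑ xs f)) (ℚ.+-monoˡ-≤ (∑ xs f) (0≤f y)))

  ∑-indicator : ∀ (b : A → Bool) c xs →
                ∑[ x ← xs ] (if b x then c else 0ℚ)
                  ≡ fromℕℚ (sumℕ (map (λ x → if b x then 1 else 0) xs)) * c
  ∑-indicator b c []       = sym (ℚ.*-zeroˡ c)
  ∑-indicator b c (x ∷ xs) with b x
  ... | false = trans (ℚ.+-identityˡ _) (∑-indicator b c xs)
  ... | true  = begin
    c + ∑[ x ← xs ] (if b x then c else 0ℚ) ≡⟨ cong (c +_) (∑-indicator b c xs) ⟩
    c + fromℕℚ k * c                       ≡⟨ cong (_+ fromℕℚ k * c) (sym (ℚ.*-identityˡ c)) ⟩
    1ℚ * c + fromℕℚ k * c                  ≡⟨ sym (ℚ.*-distribʳ-+ c 1ℚ (fromℕℚ k)) ⟩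
    (1ℚ + fromℕℚ k) * c                    ≡⟨ cong (_* c) (sym (fromℕℚ-suc k)) ⟩
    fromℕℚ (suc k) * c                     ∎
    where
    open ≡-Reasoning
    k : ℕ
    k = sumℕ (map (λ x → if b x then 1 else 0) xs)

∑-map : ∀ {A B : Set} (f : B → ℚ) (g : A → B) xs → ∑ (map g xs) f ≡ ∑ xs (f ∘ g)
∑-map f g []       = refl
∑-map f g (x ∷ xs) = cong (f (g x) +_) (∑-map f g xs)

∑-comm : ∀ {A B : Set} (f : A → B → ℚ) xs ys →
         ∑[ x ← xs ] ∑[ y ← ys ] f x y ≡ ∑[ y ← ys ] ∑[ x ← xs ] f x y
∑-comm f []       ys = sym (∑-zero ys)
∑-comm f (x ∷ xs) ys = trans (cong (∑ ys (f x) +_) (∑-comm f xs ys))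
                             (sym (∑-distrib-+ (f x) (λ y → ∑[ x ← xs ] f x y) ys))

weight : ∀ {n} → ℚ → Subset n → ℚ
weight {n} p B = (p ^ℚ ∣ B ∣) * ((1ℚ - p) ^ℚ (n ∸ ∣ B ∣))

weight-inside : ∀ {n} p (B : Subset n) → weight p (inside ∷ B) ≡ p * weight p B
weight-inside p B = ℚ.*-assoc p _ _

weight-outside : ∀ {n} p (B : Subset n) → weight p (outside ∷ B) ≡ (1ℚ - p) * weight p B
weight-outside {n} p B = begin
  (p ^ℚ ∣ B ∣) * ((1ℚ - p) ^ℚ (suc n ∸ ∣ B ∣))
    ≡⟨ cong (λ k → (p ^ℚ ∣ B ∣) * ((1ℚ - p) ^ℚ k)) (ℕ.+-∸-assoc 1 (∣p∣≤n B)) ⟩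
  (p ^ℚ ∣ B ∣) * ((1ℚ - p) * ((1ℚ - p) ^ℚ (n ∸ ∣ B ∣)))
    ≡⟨ x*[y*z]≡y*[x*z] (p ^ℚ ∣ B ∣) (1ℚ - p) _ ⟩
  (1ℚ - p) * weight p B
    ∎
  where
  open ≡-Reasoning
  x*[y*z]≡y*[x*z] : ∀ x y z → x * (y * z) ≡ y * (x * z)
  x*[y*z]≡y*[x*z] = solve 3 (λ x y z → x :* (y :* z) := y :* (x :* z)) refl

weight-nonNeg : ∀ {n p} → 0ℚ ≤ p → p ≤ 1ℚ → (B : Subset n) → 0ℚ ≤ weight p B
weight-nonNeg {n} 0≤p p≤1 B =
  *-nonNeg (^ℚ-nonNeg ∣ B ∣ 0≤p) (^ℚ-nonNeg (n ∸ ∣ B ∣) (p≤1⇒0≤1-p p≤1))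

-- Pr p E? is the probability that B_p satisfies E; probZFS G dec p unfolds to Pr p dec.
Pr : ∀ {n} {E : Subset n → Set} → ℚ → (∀ B → Dec (E B)) → ℚ
Pr {n} p E? = ∑[ B ← subsets n ] (if does (E? B) then weight p B else 0ℚ)

Pr-∷ : ∀ {n} {E : Subset (suc n) → Set} p (E? : ∀ B → Dec (E B)) →
       Pr p E? ≡ (1ℚ - p) * Pr p (λ B → E? (outside ∷ B)) + p * Pr p (λ B → E? (inside ∷ B))
Pr-∷ {n} p E? = begin
  ∑ (map (outside ∷_) (subsets n) ++ map (inside ∷_) (subsets n)) term
    ≡⟨ ∑-++ term (map (outside ∷_) (subsets n)) _ ⟩
  ∑ (map (outside ∷_) (subsets n)) term + ∑ (map (inside ∷_) (subsets n)) term
    ≡⟨ cong₂ _+_ (∑-map term (outside ∷_) (subsets n)) (∑-map term (inside ∷_) (subsets n)) ⟩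
  ∑[ B ← subsets n ] term (outside ∷ B) + ∑[ B ← subsets n ] term (inside ∷ B)
    ≡⟨ cong₂ _+_ (∑-cong (conditioned (1ℚ - p) outside (weight-outside p)) (subsets n))
                 (∑-cong (conditioned p inside (weight-inside p)) (subsets n)) ⟩
  ∑[ B ← subsets n ] ((1ℚ - p) * term′ outside B) + ∑[ B ← subsets n ] (p * term′ inside B)
    ≡⟨ cong₂ _+_ (∑-distribˡ-* (1ℚ - p) (term′ outside) (subsets n))
                 (∑-distribˡ-* p (term′ inside) (subsets n)) ⟩
  (1ℚ - p) * Pr p (λ B → E? (outside ∷ B)) + p * Pr p (λ B → E? (inside ∷ B)) ∎
  where
  open ≡-Reasoning
  term : Subset (suc n) → ℚ
  term B = if does (E? B) then weight p B else 0ℚ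
  term′ : Bool → Subset n → ℚ
  term′ s B = if does (E? (s ∷ B)) then weight p B else 0ℚ
  conditioned : ∀ c s → (∀ B → weight p (s ∷ B) ≡ c * weight p B) →
                ∀ B → term (s ∷ B) ≡ c * term′ s B
  conditioned c s weight-∷ B = trans (cong (λ x → if does (E? (s ∷ B)) then x else 0ℚ) (weight-∷ B))
                                     (if-*ʳ (does (E? (s ∷ B))) c _)

Pr-⊆ : ∀ {n} p (S : Subset n) → Pr p (S ⊆?_) ≡ p ^ℚ ∣ S ∣
Pr-⊆ p []            = ℚ.+-identityʳ 1ℚ
Pr-⊆ p (outside ∷ S) = begin
  Pr p (outside ∷ S ⊆?_)                     ≡⟨ Pr-∷ p (outside ∷ S ⊆?_) ⟩
  (1ℚ - p) * Pr p (S ⊆?_) + p * Pr p (S ⊆?_) ≡⟨ 1-p+p (Pr p (S ⊆?_)) ⟩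
  Pr p (S ⊆?_)                               ≡⟨ Pr-⊆ p S ⟩
  p ^ℚ ∣ S ∣                                 ∎
  where
  open ≡-Reasoning
  1-p+p : ∀ x → (1ℚ - p) * x + p * x ≡ x
  1-p+p = solve 2 (λ p x → (con 1ℚ :- p) :* x :+ p :* x := x) refl p
Pr-⊆ {suc n} p (inside ∷ S) = begin
  Pr p (inside ∷ S ⊆?_)
    ≡⟨ Pr-∷ p (inside ∷ S ⊆?_) ⟩
  (1ℚ - p) * ∑[ B ← subsets n ] 0ℚ + p * Pr p (S ⊆?_)
    ≡⟨ cong₂ (λ x y → (1ℚ - p) * x + p * y) (∑-zero (subsets n)) (Pr-⊆ p S) ⟩
  (1ℚ - p) * 0ℚ + p * p ^ℚ ∣ S ∣
    ≡⟨ cong (_+ p * p ^ℚ ∣ S ∣) (ℚ.*-zeroʳ (1ℚ - p)) ⟩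
  0ℚ + p * p ^ℚ ∣ S ∣
    ≡⟨ ℚ.+-identityˡ _ ⟩
  p ^ℚ ∣ inside ∷ S ∣
    ∎
  where open ≡-Reasoning

union-bound : ∀ {m n p} {E : Subset n → Set} {A : Fin m → Subset n → Set} →
              0ℚ ≤ p → p ≤ 1ℚ → (E? : ∀ B → Dec (E B)) (A? : ∀ i B → Dec (A i B)) →
              (∀ {B} → E B → ∃ λ i → A i B) → Pr p E? ≤ ∑[ i ← allFin m ] Pr p (A? i)
union-bound {m} {n} {p} 0≤p p≤1 E? A? covered = begin
  Pr p E?                                       ≤⟨ ∑-mono-≤ pointwise (subsets n) ⟩
  ∑[ B ← subsets n ] ∑[ i ← allFin m ] term B i ≡⟨ ∑-comm term (subsets n) (allFin m) ⟩
  ∑[ i ← allFin m ] Pr p (A? i)                 ∎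
  where
  open ℚ.≤-Reasoning
  term : Subset n → Fin m → ℚ
  term B i = if does (A? i B) then weight p B else 0ℚ
  0≤term : ∀ B i → 0ℚ ≤ term B i
  0≤term B i = if-nonNeg (does (A? i B)) (weight-nonNeg 0≤p p≤1 B)
  pointwise : ∀ B → (if does (E? B) then weight p B else 0ℚ) ≤ ∑[ i ← allFin m ] term B i
  pointwise B with E? B
  ... | no _  = ∑-nonNeg (0≤term B) (allFin m)
  ... | yes e = let i , a = covered e in
    ℚ.≤-trans (ℚ.≤-reflexive (sym (if-does-yes (A? i B) a))) (∈⇒≤∑ (0≤term B) (∈-allFin i))

∣tabulate∣ : ∀ {n} (f : Fin n → Bool) →
             ∣ tabulate f ∣ ≡ sumℕ (List.tabulate (λ x → if f x then 1 else 0))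
∣tabulate∣ {zero}  f = refl
∣tabulate∣ {suc n} f with f Fin.zero
... | true  = cong suc (∣tabulate∣ (f ∘ Fin.suc))
... | false = ∣tabulate∣ (f ∘ Fin.suc)

∣p[x]≔inside∣≡1+∣p[x]≔outside∣ : ∀ {n} (p : Subset n) x →
                                 ∣ p [ x ]≔ inside ∣ ≡ suc ∣ p [ x ]≔ outside ∣
∣p[x]≔inside∣≡1+∣p[x]≔outside∣ (_       ∷ p) Fin.zero    = refl
∣p[x]≔inside∣≡1+∣p[x]≔outside∣ (inside  ∷ p) (Fin.suc x) =
  cong suc (∣p[x]≔inside∣≡1+∣p[x]≔outside∣ p x)
∣p[x]≔inside∣≡1+∣p[x]≔outside∣ (outside ∷ p) (Fin.suc x) =
  ∣p[x]≔inside∣≡1+∣p[x]≔outside∣ p x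

lookup⇒[]≔-id : ∀ {A : Set} {n} (xs : Vec A n) i {x} → lookup xs i ≡ x → xs [ i ]≔ x ≡ xs
lookup⇒[]≔-id xs i refl = []≔-lookup xs i

x∉p⇒∣p[x]≔inside∣≡1+∣p∣ : ∀ {n} (p : Subset n) x → lookup p x ≡ outside →
                          ∣ p [ x ]≔ inside ∣ ≡ suc ∣ p ∣
x∉p⇒∣p[x]≔inside∣≡1+∣p∣ p x px≡outside =
  trans (∣p[x]≔inside∣≡1+∣p[x]≔outside∣ p x) (cong (suc ∘ ∣_∣) (lookup⇒[]≔-id p x px≡outside))

x∈p⇒∣p∣≡1+∣p[x]≔outside∣ : ∀ {n} (p : Subset n) x → lookup p x ≡ inside →
                           ∣ p ∣ ≡ suc ∣ p [ x ]≔ outside ∣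
x∈p⇒∣p∣≡1+∣p[x]≔outside∣ p x px≡inside =
  trans (cong ∣_∣ (sym (lookup⇒[]≔-id p x px≡inside))) (∣p[x]≔inside∣≡1+∣p[x]≔outside∣ p x)

module _ {n} (G : Graph n) where

  N : Fin n → Subset n
  N u = tabulate (adj G u)

  N[_] : Fin n → Subset n
  N[ u ] = N u [ u ]≔ inside

  N[_]∖_ : Fin n → Fin n → Subset n
  N[ u ]∖ w = N[ u ] [ w ]≔ outside

  deg≡∣N∣ : ∀ u → deg G u ≡ ∣ N u ∣
  deg≡∣N∣ u = trans (cong sumℕ (map-tabulate id (λ x → if adj G u x then 1 else 0)))
                    (sym (∣tabulate∣ (adj G u)))

  adj⇒≢ : ∀ {u w} → adj G u w ≡ true → w ≢ u
  adj⇒≢ {u} uw refl with () ← trans (sym uw) (irrefl G u)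

  ∣N[u]∖w∣≡deg : ∀ {u w} → adj G u w ≡ true → ∣ N[ u ]∖ w ∣ ≡ deg G u
  ∣N[u]∖w∣≡deg {u} {w} uw = ℕ.suc-injective (begin
    suc ∣ N[ u ]∖ w ∣  ≡⟨ sym (x∈p⇒∣p∣≡1+∣p[x]≔outside∣ N[ u ] w w∈N[u]) ⟩
    ∣ N[ u ] ∣         ≡⟨ x∉p⇒∣p[x]≔inside∣≡1+∣p∣ (N u) u u∉N[u] ⟩
    suc ∣ N u ∣        ≡⟨ cong suc (sym (deg≡∣N∣ u)) ⟩
    suc (deg G u)      ∎)
    where
    open ≡-Reasoning
    w∈N[u] : lookup N[ u ] w ≡ inside
    w∈N[u] = trans (lookup∘update′ (adj⇒≢ uw) (N u) inside)
                   (trans (lookup∘tabulate (adj G u) w) uw)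
    u∉N[u] : lookup (N u) u ≡ outside
    u∉N[u] = trans (lookup∘tabulate (adj G u) u) (irrefl G u)

  ∈N[u]∖w⇒ : ∀ {u w x} → x ∈ N[ u ]∖ w → x ≡ u ⊎ (adj G u x ≡ true × x ≢ w)
  ∈N[u]∖w⇒ {u} {w} {x} x∈ with x ≟ w | x ≟ u
  ... | yes refl | _       with () ← trans (sym ([]=⇒lookup x∈)) (lookup∘update x N[ u ] outside)
  ... | no x≢w   | yes x≡u = inj₁ x≡u
  ... | no x≢w   | no x≢u  = inj₂ (ux , x≢w)
    where
    ux : adj G u x ≡ true
    ux = begin
      adj G u x            ≡⟨ sym (lookup∘tabulate (adj G u) x) ⟩
      lookup (N u) x       ≡⟨ sym (lookup∘update′ x≢u (N u) inside) ⟩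
      lookup N[ u ] x      ≡⟨ sym (lookup∘update′ x≢w N[ u ] outside) ⟩
      lookup (N[ u ]∖ w) x ≡⟨ []=⇒lookup x∈ ⟩
      inside               ∎
      where open ≡-Reasoning

  CanForce : Subset n → Fin n → Fin n → Set
  CanForce B u w = T (adj G u w) × N[ u ]∖ w ⊆ B

  canForce? : ∀ B u w → Dec (CanForce B u w)
  canForce? B u w = T? (adj G u w) ×-dec N[ u ]∖ w ⊆? B

  Blue⇒∈ : ∀ {B} → ¬ ∃₂ (CanForce B) → ∀ {v} → Blue G B v → v ∈ B
  Blue⇒∈ stuck (start v∈B) = v∈B
  Blue⇒∈ {B} stuck (force u v u-blue uv others-blue) =
    ⊥-elim (stuck (u , v , Equivalence.from T-≡ uv , N[u]∖v⊆B))
    where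
    N[u]∖v⊆B : N[ u ]∖ v ⊆ B
    N[u]∖v⊆B x∈ with ∈N[u]∖w⇒ x∈
    ... | inj₁ refl        = Blue⇒∈ stuck u-blue
    ... | inj₂ (ux , x≢v) = Blue⇒∈ stuck (others-blue _ ux x≢v)

  IsZFS⇒CanForce : HasEdge G → ∀ {B} → IsZFS G B → ∃₂ (CanForce B)
  IsZFS⇒CanForce (u , w , uw) {B} zfs with any? (λ u → any? (canForce? B u))
  ... | yes canForce = canForce
  ... | no  stuck    =
    ⊥-elim (stuck (u , w , Equivalence.from T-≡ uw , λ {x} _ → Blue⇒∈ stuck (zfs x)))

  Pr-canForce : ∀ p u w → Pr p (λ B → canForce? B u w) ≡ (if adj G u w then p ^ℚ deg G u else 0ℚ)
  Pr-canForce p u w = by-adj (adj G u w) refl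
    where
    by-adj : ∀ b → adj G u w ≡ b →
             Pr p (λ B → T? b ×-dec N[ u ]∖ w ⊆? B) ≡ (if b then p ^ℚ deg G u else 0ℚ)
    by-adj true  uw = trans (Pr-⊆ p (N[ u ]∖ w)) (cong (p ^ℚ_) (∣N[u]∖w∣≡deg uw))
    by-adj false _  = ∑-zero (subsets n)

lemma3p1 : (n : ℕ) (G : Graph n) → HasEdge G →
           (dec : (B : Subset n) → Dec (IsZFS G B)) →
           (p : ℚ) → 0ℚ ≤ p → p ≤ 1ℚ →
           probZFS G dec p ≤ degBound G p
lemma3p1 n G hasEdge dec p 0≤p p≤1 = begin
  probZFS G dec p
    ≤⟨ union-bound 0≤p p≤1 dec canForceFrom? (IsZFS⇒CanForce G hasEdge) ⟩
  ∑[ u ← allFin n ] Pr p (canForceFrom? u)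
    ≤⟨ ∑-mono-≤ (λ u → union-bound 0≤p p≤1 (canForceFrom? u) (λ w B → canForce? G B u w) id)
                (allFin n) ⟩
  ∑[ u ← allFin n ] ∑[ w ← allFin n ] Pr p (λ B → canForce? G B u w)
    ≡⟨ ∑-cong (λ u → ∑-cong (Pr-canForce G p u) (allFin n)) (allFin n) ⟩
  ∑[ u ← allFin n ] ∑[ w ← allFin n ] (if adj G u w then p ^ℚ deg G u else 0ℚ)
    ≡⟨ ∑-cong (λ u → ∑-indicator (adj G u) (p ^ℚ deg G u) (allFin n)) (allFin n) ⟩
  degBound G p ∎
  where
  open ℚ.≤-Reasoning
  canForceFrom? : ∀ u B → Dec (∃ (CanForce G B u))
  canForceFrom? u B = any? (canForce? G B u)
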